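{- Let $\Gamma$ be the semigroup associated to an irreducible plane curve singularity, minimally generated by $r_0<r_1<\cdots<r_h$, with conductor $c=\mathrm c(\Gamma)$. If $h\ge 2$, then $h\le \log_2\left(\frac{\sqrt{60c+1}+9}{10}\right)$.
   Context: A numerical semigroup is a submonoid $\Gamma$ of $(\mathbb N,+)$ with finite complement in $\mathbb N$; $\mathrm F(\Gamma)$ is the largest integer not in $\Gamma$ and $\mathrm c(\Gamma)=\mathrm F(\Gamma)+1$. $\langle X\rangle$ denotes the submonoid of $\mathbb N$ generated by $X$. For minimal generators listed in a fixed order $(r_0,\ldots,r_h)$, set $d_k=\gcd(r_0,\ldots,r_{k-1})$ for $k=1,\ldots,h+1$, $e_k=d_k/d_{k+1}$ for $k=1,\ldots,h$, and $\Gamma_k=\langle r_0/d_{k+1},\ldots,r_k/d_{k+1}\rangle$. Gluing: if $A$ is the minimal generating set of a numerical semigroup and $A=A_1\cup A_2$ is a nontrivial partition with $a_i=\gcd(A_i)$, then $A$ is the gluing of $A_1$ and $A_2$ if $\mathrm{lcm}(a_1,a_2)\in\langle A_1\rangle\cap\langle A_2\rangle$. $\Gamma$ is free for the arrangement $(r_0,\ldots,r_h)$ if either $h=0$ (so $r_0=1$) or $\{r_0,\ldots,r_h\}$ is the gluing of $\{r_0,\ldots,r_{h-1}\}$ and $\{r_h\}$ and $\Gamma_{h-1}$ is free for the arrangement $(r_0/d_h,\ldots,r_{h-1}/d_h)$. $\Gamma$ is telescopic if it is free for the increasing arrangement $r_0<\cdots<r_h$. $\Gamma$ is the semigroup associated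 to an irreducible plane curve singularity if it is telescopic and $e_kr_k<r_{k+1}$ for all $k=1,\ldots,h-1$. -}

module Defs where

open import Data.Nat using (ℕ; zero; suc; _+_; _*_; _∸_; _^_; _≤_; _<_; _/_)
open import Data.Nat.GCD using (gcd)
open import Data.Nat.LCM using (lcm)
open import Data.Product using (Σ; _×_; ∃)
open import Relation.Binary.PropositionalEquality using (_≡_)
open import Relation.Nullary using (¬_)

-- A finite sequence r₀,…,r_h is represented as a function r : ℕ → ℕ of which
-- only the values r 0, …, r h matter.

sumTo : ℕ → (ℕ → ℕ) → ℕ
sumTo zero    f = 0
sumTo (suc n) f = sumTo n f + f n

-- gcd (r₀,…,r_{k-1})  (gcd of the empty list is 0)
gcdTo : (ℕ → ℕ) → ℕ → ℕ
gcdTo r zero    = 0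
gcdTo r (suc k) = gcd (gcdTo r k) (r k)

-- natural division, with the (never used) convention m / 0 = 0
divℕ : ℕ → ℕ → ℕ
divℕ m zero    = 0
divℕ m (suc k) = m / suc k

InMonoid : (ℕ → ℕ) → ℕ → ℕ → Set
InMonoid r k x = Σ (ℕ → ℕ) λ a → sumTo (suc k) (λ i → a i * r i) ≡ x

InMonoidWithout : (ℕ → ℕ) → ℕ → ℕ → ℕ → Set
InMonoidWithout r k i x =
  Σ (ℕ → ℕ) λ a → (a i ≡ 0) × (sumTo (suc k) (λ j → a j * r j) ≡ x)

IsNumerical : (ℕ → ℕ) → ℕ → Set
IsNumerical r k = ∃ λ N → ∀ n → N ≤ n → InMonoid r k n

IsMinimal : (ℕ → ℕ) → ℕ → Set
IsMinimal r k = ∀ i → i ≤ k → ¬ InMonoidWithout r k i (r i)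

IsConductor : (ℕ → ℕ) → ℕ → ℕ → Set
IsConductor r k c =
  (∀ n → c ≤ n → InMonoid r k n) ×
  (∀ m → (∀ n → m ≤ n → InMonoid r k n) → c ≤ m)

-- {r₀,…,r_k} is the gluing of {r₀,…,r_{k-1}} and {r_k} (k ≥ 1), where the
-- whole set is required to be the minimal generating set of a numerical semigroup:
-- lcm(gcd(r₀..r_{k-1}), r_k) ∈ ⟨r₀..r_{k-1}⟩ ∩ ⟨r_k⟩
IsGluing : (ℕ → ℕ) → ℕ → Set
IsGluing r zero    = ¬ (0 ≡ 0)   -- no nontrivial partition of a singleton
IsGluing r (suc k) =
  IsNumerical r (suc k) × IsMinimal r (suc k) ×
  InMonoid r k (lcm (gcdTo r (suc k)) (r (suc k))) ×
  ∃ λ m → m * r (suc k) ≡ lcm (gcdTo r (suc k)) (r (suc k))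

IsFree : ℕ → (ℕ → ℕ) → Set
IsFree zero    r = r 0 ≡ 1
IsFree (suc h) r =
  IsGluing r (suc h) ×
  IsFree h (λ i → divℕ (r i) (gcdTo r (suc h)))

StrictlyIncreasing : (ℕ → ℕ) → ℕ → Set
StrictlyIncreasing r h = ∀ i → i < h → r i < r (suc i)

dk : (ℕ → ℕ) → ℕ → ℕ
dk r k = gcdTo r k

ek : (ℕ → ℕ) → ℕ → ℕ
ek r k = divℕ (dk r k) (dk r (suc k))

IsTelescopic : (ℕ → ℕ) → ℕ → Set
IsTelescopic r h = IsFree h r

IsPlaneCurveSemigroup : (ℕ → ℕ) → ℕ → Set
IsPlaneCurveSemigroup r h =
  IsTelescopic r h × (∀ k → 1 ≤ k → k < h → ek r k * r k < r (suc k))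

-- Write Γ = ⟨r₀,…,r_h⟩ as the gluing of d·Γ′ and r_h, with d = gcd(r₀,…,r_{h-1})
-- and Γ′ = ⟨r₀/d,…,r_{h-1}/d⟩. Then F(Γ) = d·F(Γ′) + (d − 1)·r_h, and since
-- e_k ≥ 2, d_k ≥ 2 and r_{k+1} > e_k r_k, the reduced generators r_k/d_{k+1} grow
-- at least fourfold in k, so 3 r_h + 1 ≥ 10·4^{h-1}. Induction on h then gives
-- 3 F(Γ) + 9·2^h ≥ 5·4^h + 1, i.e. 5 s² − 9 s + 4 ≤ 3 c for s = 2^h, which is
-- (10 s − 9)² ≤ 60 c + 1.
module Submission where

open import Data.Nat
open import Data.Nat.Properties
open import Data.Nat.Divisibility
open import Data.Nat.DivMod using (m/n*n≡m; m*n/o*n≡m/o; n/1≡n)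
open import Data.Nat.GCD using (gcd; gcd[m,n]∣m; gcd[m,n]∣n; c*gcd[m,n]≡gcd[cm,cn]; gcd-zeroˡ)
open import Data.Nat.LCM using (lcm; gcd*lcm)
open import Data.Nat.Coprimality using (Coprime; gcd≡1⇒coprime; coprime-divisor)
open import Data.Nat.Tactic.RingSolver using (solve-∀)
open import Data.Product using (∃; _,_; proj₁; proj₂)
open import Data.Sum using (inj₁; inj₂)
open import Data.Empty using (⊥-elim)
open import Relation.Nullary using (¬_; yes; no)
open import Relation.Binary.PropositionalEquality
open import Defs

sumTo-cong : ∀ n {f g : ℕ → ℕ} → (∀ i → i < n → f i ≡ g i) → sumTo n f ≡ sumTo n g
sumTo-cong zero    f≡g = refl
sumTo-cong (suc n) f≡g =
  cong₂ _+_ (sumTo-cong n (λ i i<n → f≡g i (m<n⇒m<1+n i<n))) (f≡g n ≤-refl)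

sumTo-+ : ∀ n (f g : ℕ → ℕ) → sumTo n (λ i → f i + g i) ≡ sumTo n f + sumTo n g
sumTo-+ zero    f g = refl
sumTo-+ (suc n) f g rewrite sumTo-+ n f g = interchange (sumTo n f) (sumTo n g) (f n) (g n)
  where
  interchange : ∀ a b c d → a + b + (c + d) ≡ a + c + (b + d)
  interchange = solve-∀

sumTo-*ˡ : ∀ n c (f : ℕ → ℕ) → sumTo n (λ i → c * f i) ≡ c * sumTo n f
sumTo-*ˡ zero    c f = sym (*-zeroʳ c)
sumTo-*ˡ (suc n) c f rewrite sumTo-*ˡ n c f = sym (*-distribˡ-+ c (sumTo n f) (f n))

∣-sumTo : ∀ n {d} (f : ℕ → ℕ) → (∀ i → i < n → d ∣ f i) → d ∣ sumTo n f
∣-sumTo zero    f d∣f = _ ∣0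
∣-sumTo (suc n) f d∣f =
  ∣m∣n⇒∣m+n (∣-sumTo n f (λ i i<n → d∣f i (m<n⇒m<1+n i<n))) (d∣f n ≤-refl)

gcdTo-∣ : ∀ r k i → i < k → gcdTo r k ∣ r i
gcdTo-∣ r (suc k) i i<1+k with m<1+n⇒m<n∨m≡n i<1+k
... | inj₁ i<k  = ∣-trans (gcd[m,n]∣m (gcdTo r k) (r k)) (gcdTo-∣ r k i i<k)
... | inj₂ refl = gcd[m,n]∣n (gcdTo r k) (r k)

gcdTo-∣-InMonoid : ∀ {r k x} → InMonoid r k x → gcdTo r (suc k) ∣ x
gcdTo-∣-InMonoid {r} {k} (a , Σ≡x) = subst (_ ∣_) Σ≡x
  (∣-sumTo (suc k) _ (λ i i<1+k → ∣-trans (gcdTo-∣ r (suc k) i i<1+k) (n∣m*n (a i))))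

gcdTo-*ʳ : ∀ d k {r s : ℕ → ℕ} → (∀ i → i < k → s i * d ≡ r i) → gcdTo s k * d ≡ gcdTo r k
gcdTo-*ʳ d zero    s*d≡r = refl
gcdTo-*ʳ d (suc k) {r} {s} s*d≡r = begin
  gcd (gcdTo s k) (s k) * d     ≡⟨ *-comm _ d ⟩
  d * gcd (gcdTo s k) (s k)     ≡⟨ c*gcd[m,n]≡gcd[cm,cn] d _ _ ⟩
  gcd (d * gcdTo s k) (d * s k) ≡⟨ cong₂ gcd (trans (*-comm d _) previous)
                                               (trans (*-comm d _) (s*d≡r k ≤-refl)) ⟩
  gcd (gcdTo r k) (r k)         ∎
  where
  open ≡-Reasoning
  previous : gcdTo s k * d ≡ gcdTo r k
  previous = gcdTo-*ʳ d k (λ i i<k → s*d≡r i (m<n⇒m<1+n i<k))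

numerical⇒gcdTo≡1 : ∀ {r k} → IsNumerical r k → gcdTo r (suc k) ≡ 1
numerical⇒gcdTo≡1 {r} {k} (N , large∈Γ) =
  ∣1⇒≡1 (∣m+n∣m⇒∣n (∣-large (N + 1) (m≤m+n N 1)) (∣-large N ≤-refl))
  where
  ∣-large : ∀ n → N ≤ n → gcdTo r (suc k) ∣ n
  ∣-large n N≤n = gcdTo-∣-InMonoid (large∈Γ n N≤n)

divℕ-*-cancelʳ : ∀ {m n} → 0 < n → n ∣ m → divℕ m n * n ≡ m
divℕ-*-cancelʳ {n = suc n} _ n∣m = m/n*n≡m n∣m

divℕ-*-*-cancelʳ : ∀ m n d → 0 < d → divℕ (m * d) (n * d) ≡ divℕ m n
divℕ-*-*-cancelʳ m zero    d       _ = refl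
divℕ-*-*-cancelʳ m (suc n) (suc d) _ = m*n/o*n≡m/o m (suc d) (suc n)

InMonoid⇒InMonoidWithout-last : ∀ {r k x} → InMonoid r k x → InMonoidWithout r (suc k) (suc k) x
InMonoid⇒InMonoidWithout-last {r} {k} (a , Σ≡x) = a′ , a′-last , (begin
  sumTo (suc k) (λ j → a′ j * r j) + a′ (suc k) * r (suc k)
    ≡⟨ cong₂ _+_ (sumTo-cong (suc k) (λ j j<1+k → cong (_* r j) (a′-below j j<1+k)))
                 (cong (_* r (suc k)) a′-last) ⟩
  sumTo (suc k) (λ j → a j * r j) + 0
    ≡⟨ +-identityʳ _ ⟩
  sumTo (suc k) (λ j → a j * r j)
    ≡⟨ Σ≡x ⟩
  _ ∎)
  where
  open ≡-Reasoning
  a′ : ℕ → ℕ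
  a′ j with j <? suc k
  ... | yes _ = a j
  ... | no  _ = 0
  a′-below : ∀ j → j < suc k → a′ j ≡ a j
  a′-below j j<1+k with j <? suc k
  ... | yes _    = refl
  ... | no  j≮1+k = ⊥-elim (j≮1+k j<1+k)
  a′-last : a′ (suc k) ≡ 0
  a′-last with suc k <? suc k
  ... | yes k<k = ⊥-elim (<-irrefl refl k<k)
  ... | no  _   = refl

-- d = 0 would force r₀ = 0 (gcd of the empty list is 0), and d = 1 would put
-- r_{k+1} = lcm 1 r_{k+1} into ⟨r₀,…,r_k⟩; both contradict minimality.
gluing⇒2≤gcdTo : ∀ {r k} → IsGluing r (suc k) → 2 ≤ gcdTo r (suc k)
gluing⇒2≤gcdTo {r} {k} (_ , minimal , lcm∈Γ , _) with gcdTo r (suc k) in d≡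
... | suc (suc _) = s≤s (s≤s z≤n)
... | zero = ⊥-elim (minimal 0 z≤n ((λ _ → 0) , refl , trans (sumTo-*ˡ (suc (suc k)) 0 r) (sym r₀≡0)))
  where
  r₀≡0 : r 0 ≡ 0
  r₀≡0 = 0∣⇒≡0 (subst (_∣ r 0) d≡ (gcdTo-∣ r (suc k) 0 (s≤s z≤n)))
... | suc zero = ⊥-elim (minimal (suc k) ≤-refl
        (InMonoid⇒InMonoidWithout-last (subst (InMonoid r k) (lcm[1,n]≡n (r (suc k))) lcm∈Γ)))
  where
  lcm[1,n]≡n : ∀ n → lcm 1 n ≡ n
  lcm[1,n]≡n n = begin
    lcm 1 n           ≡⟨ sym (*-identityˡ _) ⟩
    1 * lcm 1 n       ≡⟨ cong (_* lcm 1 n) (sym (gcd-zeroˡ n)) ⟩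
    gcd 1 n * lcm 1 n ≡⟨ gcd*lcm 1 n ⟩
    1 * n             ≡⟨ *-identityˡ n ⟩
    n                 ∎
    where open ≡-Reasoning

PlaneCurveInequalities : (ℕ → ℕ) → ℕ → Set
PlaneCurveInequalities r h = ∀ k → 1 ≤ k → k < h → ek r k * r k < r (suc k)

quotientByGcd : ℕ → (ℕ → ℕ) → ℕ → ℕ
quotientByGcd h r i = divℕ (r i) (gcdTo r (suc h))

module Quotient {h : ℕ} {r : ℕ → ℕ} (glue : IsGluing r (suc h)) where

  d : ℕ
  d = gcdTo r (suc h)

  r′ : ℕ → ℕ
  r′ = quotientByGcd h r

  2≤d : 2 ≤ d
  2≤d = gluing⇒2≤gcdTo glue

  0<d : 0 < d
  0<d = ≤-trans (s≤s z≤n) 2≤d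

  instance
    d-nonZero : NonZero d
    d-nonZero = >-nonZero 0<d

  gcd[d,r_last]≡1 : gcd d (r (suc h)) ≡ 1
  gcd[d,r_last]≡1 = numerical⇒gcdTo≡1 (proj₁ glue)

  coprime : Coprime d (r (suc h))
  coprime = gcd≡1⇒coprime gcd[d,r_last]≡1

  r′*d≡r : ∀ i → i ≤ h → r′ i * d ≡ r i
  r′*d≡r i i≤h = divℕ-*-cancelʳ 0<d (gcdTo-∣ r (suc h) i (s≤s i≤h))

  gcdTo-r′*d : ∀ k → k ≤ suc h → gcdTo r′ k * d ≡ gcdTo r k
  gcdTo-r′*d k k≤1+h = gcdTo-*ʳ d k (λ i i<k → r′*d≡r i (≤-pred (≤-trans i<k k≤1+h)))

  gcdTo-r′≡1 : gcdTo r′ (suc h) ≡ 1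
  gcdTo-r′≡1 = *-cancelʳ-≡ _ 1 d (trans (gcdTo-r′*d (suc h) ≤-refl) (sym (*-identityˡ d)))

  ek-r′ : ∀ k → k ≤ h → ek r k ≡ ek r′ k
  ek-r′ k k≤h = trans (cong₂ divℕ (sym (gcdTo-r′*d k (m≤n⇒m≤1+n k≤h))) (sym (gcdTo-r′*d (suc k) (s≤s k≤h))))
                      (divℕ-*-*-cancelʳ (gcdTo r′ k) (gcdTo r′ (suc k)) d 0<d)

  ek-last : ek r h ≡ gcdTo r′ h
  ek-last = trans (ek-r′ h ≤-refl) (trans (cong (divℕ (gcdTo r′ h)) gcdTo-r′≡1) (n/1≡n _))

  sumTo-r : ∀ (a : ℕ → ℕ) → sumTo (suc h) (λ i → a i * r i) ≡ d * sumTo (suc h) (λ i → a i * r′ i)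
  sumTo-r a = trans (sumTo-cong (suc h) (λ i i<1+h → trans (cong (a i *_) (sym (r′*d≡r i (≤-pred i<1+h))))
                                                         (regroup (a i) (r′ i) d)))
                    (sumTo-*ˡ (suc h) d (λ i → a i * r′ i))
    where
    regroup : ∀ a b c → a * (b * c) ≡ c * (a * b)
    regroup = solve-∀

  -- the gluing condition, since lcm(d, r_{h+1}) = d·r_{h+1} for coprime d and r_{h+1}
  last∈Γ′ : InMonoid r′ h (r (suc h))
  last∈Γ′ with proj₁ (proj₂ (proj₂ glue))
  ... | b , Σ≡lcm = b , *-cancelˡ-≡ _ _ d (trans (sym (sumTo-r b)) (trans Σ≡lcm lcm≡d*r_last))
    where
    lcm≡d*r_last : lcm d (r (suc h)) ≡ d * r (suc h)
    lcm≡d*r_last = trans (sym (*-identityˡ _)) (trans (cong (_* lcm d (r (suc h))) (sym gcd[d,r_last]≡1))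
                                                      (gcd*lcm d (r (suc h))))

  increasing-r′ : StrictlyIncreasing r (suc h) → StrictlyIncreasing r′ h
  increasing-r′ r< i i<h = *-cancelʳ-< _ _ _
    (subst₂ _<_ (sym (r′*d≡r i (<⇒≤ i<h))) (sym (r′*d≡r (suc i) i<h)) (r< i (m<n⇒m<1+n i<h)))

  plane-r′ : PlaneCurveInequalities r (suc h) → PlaneCurveInequalities r′ h
  plane-r′ ineq k 1≤k k<h = *-cancelʳ-< _ _ _
    (subst₂ _<_ ek*r≡ek′*r′*d (sym (r′*d≡r (suc k) k<h)) (ineq k 1≤k (m<n⇒m<1+n k<h)))
    where
    ek*r≡ek′*r′*d : ek r k * r k ≡ ek r′ k * r′ k * d
    ek*r≡ek′*r′*d = trans (cong₂ _*_ (ek-r′ k (<⇒≤ k<h)) (sym (r′*d≡r k (<⇒≤ k<h))))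
                          (sym (*-assoc (ek r′ k) (r′ k) d))

-- F(Γ) + r₀, computed by F(Γ) = d·F(Γ′) + (d − 1)·r_{h+1}; the base value 0 is
-- F(ℕ) + 1 with F(ℕ) = −1. The shift keeps everything in ℕ.
shiftedFrobenius : ℕ → (ℕ → ℕ) → ℕ
shiftedFrobenius zero    r = 0
shiftedFrobenius (suc h) r =
  gcdTo r (suc h) * shiftedFrobenius h (quotientByGcd h r) + (gcdTo r (suc h) ∸ 1) * r (suc h)

-- y ∉ r₀ + Γ: for y ≥ r₀ this says that y − r₀ is a gap of Γ.
NotInShifted : (ℕ → ℕ) → ℕ → ℕ → Set
NotInShifted r h y = ∀ (a : ℕ → ℕ) → ¬ (sumTo (suc h) (λ i → a i * r i) + r 0 ≡ y)

gap-lift : ∀ d X Y a R → 0 < d → Coprime d R →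
  d * X + a * R ≡ d * Y + (d ∸ 1) * R → ∃ λ t → X + t * R ≡ Y
gap-lift (suc e) X Y a R _ coprime eq =
  lift (coprime-divisor coprime (subst (suc e ∣_) (*-comm (suc a) R) d∣[1+a]*R))
  where
  open ≡-Reasoning
  d : ℕ
  d = suc e
  [1+a]-form : d * X + suc a * R ≡ d * (Y + R)
  [1+a]-form = begin
    d * X + suc a * R     ≡⟨ regroup d X a R ⟩
    d * X + a * R + R     ≡⟨ cong (_+ R) eq ⟩
    d * Y + e * R + R     ≡⟨ distrib e Y R ⟩
    d * (Y + R)           ∎
    where
    regroup : ∀ d X a R → d * X + suc a * R ≡ d * X + a * R + R
    regroup = solve-∀
    distrib : ∀ e Y R → suc e * Y + e * R + R ≡ suc e * (Y + R)
    distrib = solve-∀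
  d∣[1+a]*R : d ∣ suc a * R
  d∣[1+a]*R = ∣m+n∣m⇒∣n (subst (d ∣_) (sym [1+a]-form) (m∣m*n (Y + R))) (m∣m*n X)
  lift : d ∣ suc a → ∃ λ t → X + t * R ≡ Y
  lift (divides (suc t) 1+a≡[1+t]*d) = t , +-cancelʳ-≡ R _ _ (*-cancelˡ-≡ _ _ d (begin
    d * (X + t * R + R)       ≡⟨ expand d X t R ⟩
    d * X + (suc t * d) * R   ≡⟨ cong (λ m → d * X + m * R) (sym 1+a≡[1+t]*d) ⟩
    d * X + suc a * R         ≡⟨ [1+a]-form ⟩
    d * (Y + R)               ∎))
    where
    expand : ∀ d X t R → d * (X + t * R + R) ≡ d * X + (suc t * d) * R
    expand = solve-∀

shiftedFrobenius-gap : ∀ h r → IsFree h r → NotInShifted r h (shiftedFrobenius h r)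
shiftedFrobenius-gap zero r r₀≡1 a eq rewrite r₀≡1 = m+1+n≢0 _ eq
shiftedFrobenius-gap (suc h) r (glue , free′) a eq =
  shiftedFrobenius-gap h r′ free′ (λ i → a i + t * b i) (begin
    sumTo (suc h) (λ i → (a i + t * b i) * r′ i) + r′ 0 ≡⟨ cong (_+ r′ 0) Σ≡A+t*R ⟩
    A + t * R + r′ 0                                     ≡⟨ swap A (t * R) (r′ 0) ⟩
    A + r′ 0 + t * R                                     ≡⟨ A+r′₀+t*R≡y′ ⟩
    shiftedFrobenius h r′                                ∎)
  where
  open Quotient glue
  open ≡-Reasoning
  R : ℕ
  R = r (suc h)
  A : ℕ
  A = sumTo (suc h) (λ i → a i * r′ i)
  b : ℕ → ℕ
  b = proj₁ last∈Γ′
  swap : ∀ x y z → x + y + z ≡ x + z + y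
  swap = solve-∀
  factor : ∀ d A c r₀ → d * (A + r₀) + c ≡ d * A + c + r₀ * d
  factor = solve-∀
  lifted : ∃ λ t → A + r′ 0 + t * R ≡ shiftedFrobenius h r′
  lifted = gap-lift d (A + r′ 0) (shiftedFrobenius h r′) (a (suc h)) R 0<d coprime (begin
    d * (A + r′ 0) + a (suc h) * R              ≡⟨ factor d A _ (r′ 0) ⟩
    d * A + a (suc h) * R + r′ 0 * d            ≡⟨ cong₂ (λ u v → u + a (suc h) * R + v)
                                                          (sym (sumTo-r a)) (r′*d≡r 0 z≤n) ⟩
    sumTo (suc (suc h)) (λ i → a i * r i) + r 0 ≡⟨ eq ⟩
    shiftedFrobenius (suc h) r                  ∎)
  t : ℕ
  t = proj₁ lifted
  A+r′₀+t*R≡y′ : A + r′ 0 + t * R ≡ shiftedFrobenius h r′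
  A+r′₀+t*R≡y′ = proj₂ lifted
  distrib : ∀ a t b r → (a + t * b) * r ≡ a * r + t * (b * r)
  distrib = solve-∀
  Σ≡A+t*R : sumTo (suc h) (λ i → (a i + t * b i) * r′ i) ≡ A + t * R
  Σ≡A+t*R = trans (sumTo-cong (suc h) (λ i _ → distrib (a i) t (b i) (r′ i)))
            (trans (sumTo-+ (suc h) _ _)
                   (cong (A +_) (trans (sumTo-*ˡ (suc h) t (λ i → b i * r′ i)) (cong (t *_) (proj₂ last∈Γ′)))))

quadruple-bound : ∀ x R P → 4 * x < R → 10 * P ≤ 3 * x + 1 → 10 * (4 * P) ≤ 3 * R + 1
quadruple-bound x R P 4x<R 10P≤3x+1 = begin
  10 * (4 * P)     ≡⟨ *-comm-4 P ⟩
  4 * (10 * P)     ≤⟨ *-monoʳ-≤ 4 10P≤3x+1 ⟩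
  4 * (3 * x + 1)  ≡⟨ regroup x ⟩
  3 * suc (4 * x) + 1 ≤⟨ +-monoˡ-≤ 1 (*-monoʳ-≤ 3 4x<R) ⟩
  3 * R + 1        ∎
  where
  open ≤-Reasoning
  *-comm-4 : ∀ P → 10 * (4 * P) ≡ 4 * (10 * P)
  *-comm-4 = solve-∀
  regroup : ∀ x → 4 * (3 * x + 1) ≡ 3 * suc (4 * x) + 1
  regroup = solve-∀

last-generator-bound : ∀ h r → IsFree (suc h) r → StrictlyIncreasing r (suc h) →
  PlaneCurveInequalities r (suc h) → 10 * 4 ^ h ≤ 3 * r (suc h) + 1
last-generator-bound zero r (glue , r′₀≡1) r< _ =
  +-monoˡ-≤ 1 (*-monoʳ-≤ 3 (≤-trans (s≤s 2≤r₀) (r< 0 (s≤s z≤n))))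
  where
  open Quotient glue
  2≤r₀ : 2 ≤ r 0
  2≤r₀ = subst (2 ≤_) (trans (sym (*-identityˡ d)) (trans (cong (_* d) (sym r′₀≡1)) (r′*d≡r 0 z≤n))) 2≤d
last-generator-bound (suc h) r (glue , free′) r< ineq =
  quadruple-bound (r′ (suc h)) (r (suc (suc h))) (4 ^ h) 4r′<R
    (last-generator-bound h r′ free′ (increasing-r′ r<) (plane-r′ ineq))
  where
  open Quotient glue
  open ≤-Reasoning
  e : ℕ
  e = ek r (suc h)
  2≤e : 2 ≤ e
  2≤e = subst (2 ≤_) (sym ek-last) (gluing⇒2≤gcdTo (proj₁ free′))
  4*x≡2*[x*2] : ∀ x → 4 * x ≡ 2 * (x * 2)
  4*x≡2*[x*2] = solve-∀
  4r′<R : 4 * r′ (suc h) < r (suc (suc h))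
  4r′<R = begin-strict
    4 * r′ (suc h)       ≡⟨ 4*x≡2*[x*2] (r′ (suc h)) ⟩
    2 * (r′ (suc h) * 2) ≤⟨ *-mono-≤ 2≤e (*-monoʳ-≤ (r′ (suc h)) 2≤d) ⟩
    e * (r′ (suc h) * d) ≡⟨ cong (e *_) (r′*d≡r (suc h) ≤-refl) ⟩
    e * r (suc h)        <⟨ ineq (suc h) (s≤s z≤n) ≤-refl ⟩
    r (suc (suc h))      ∎

shiftedFrobenius-bound-step : ∀ d r₀ y R P Q → 2 ≤ d → 1 ≤ Q → Q ≤ P →
  3 * r₀ + 5 * P + 1 ≤ 3 * y + 9 * Q → 10 * P ≤ 3 * R + 1 →
  3 * (r₀ * d) + 5 * (4 * P) + 1 ≤ 3 * (d * y + (d ∸ 1) * R) + 9 * (2 * Q)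
shiftedFrobenius-bound-step (suc (suc t)) r₀ y R P Q (s≤s (s≤s z≤n)) 1≤Q Q≤P previous 10P≤3R+1 =
  +-cancelʳ-≤ (t * (9 * Q) + 1) _ _ (begin
    3 * (r₀ * (2 + t)) + 5 * (4 * P) + 1 + (t * (9 * Q) + 1)
      ≤⟨ m≤m+n _ (5 * t * P + t) ⟩
    3 * (r₀ * (2 + t)) + 5 * (4 * P) + 1 + (t * (9 * Q) + 1) + (5 * t * P + t)
      ≡⟨ collect r₀ t P Q ⟩
    (2 + t) * (3 * r₀ + 5 * P + 1) + t * (9 * Q) + 10 * P
      ≤⟨ +-mono-≤ (+-mono-≤ (*-monoʳ-≤ (2 + t) previous) (*-monoʳ-≤ t 9Q≤3R)) 10P≤3R+1 ⟩
    (2 + t) * (3 * y + 9 * Q) + t * (3 * R) + (3 * R + 1)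
      ≡⟨ spread y t R Q ⟩
    3 * ((2 + t) * y + suc t * R) + 9 * (2 * Q) + (t * (9 * Q) + 1) ∎)
  where
  open ≤-Reasoning
  collect : ∀ r₀ t P Q → 3 * (r₀ * (2 + t)) + 5 * (4 * P) + 1 + (t * (9 * Q) + 1) + (5 * t * P + t)
                         ≡ (2 + t) * (3 * r₀ + 5 * P + 1) + t * (9 * Q) + 10 * P
  collect = solve-∀
  spread : ∀ y t R Q → (2 + t) * (3 * y + 9 * Q) + t * (3 * R) + (3 * R + 1)
                       ≡ 3 * ((2 + t) * y + suc t * R) + 9 * (2 * Q) + (t * (9 * Q) + 1)
  spread = solve-∀
  9Q+Q≡10Q : ∀ Q → 9 * Q + Q ≡ 10 * Q
  9Q+Q≡10Q = solve-∀
  9Q≤3R : 9 * Q ≤ 3 * R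
  9Q≤3R = +-cancelʳ-≤ 1 _ _ (begin
    9 * Q + 1 ≤⟨ +-monoʳ-≤ (9 * Q) 1≤Q ⟩
    9 * Q + Q ≡⟨ 9Q+Q≡10Q Q ⟩
    10 * Q    ≤⟨ *-monoʳ-≤ 10 Q≤P ⟩
    10 * P    ≤⟨ 10P≤3R+1 ⟩
    3 * R + 1 ∎)

shiftedFrobenius-bound : ∀ h r → IsFree h r → StrictlyIncreasing r h → PlaneCurveInequalities r h →
  3 * r 0 + 5 * 4 ^ h + 1 ≤ 3 * shiftedFrobenius h r + 9 * 2 ^ h
shiftedFrobenius-bound zero    r r₀≡1 _ _ rewrite r₀≡1 = ≤-refl
shiftedFrobenius-bound (suc h) r free@(glue , free′) r< ineq =
  subst (λ r₀ → 3 * r₀ + 5 * 4 ^ suc h + 1 ≤ 3 * shiftedFrobenius (suc h) r + 9 * 2 ^ suc h)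
        (r′*d≡r 0 z≤n)
        (shiftedFrobenius-bound-step d (r′ 0) (shiftedFrobenius h r′) (r (suc h)) (4 ^ h) (2 ^ h)
          2≤d (m^n>0 2 h) (^-monoˡ-≤ h (s≤s (s≤s z≤n)))
          (shiftedFrobenius-bound h r′ free′ (increasing-r′ r<) (plane-r′ ineq))
          (last-generator-bound h r free r< ineq))
  where open Quotient glue

NotInShifted⇒<conductor+r₀ : ∀ {r h c y} → IsConductor r h c → NotInShifted r h y → y < c + r 0
NotInShifted⇒<conductor+r₀ {r} {c = c} {y} (large∈Γ , _) y∉r₀+Γ = ≰⇒> λ c+r₀≤y →
  let (a , Σ≡y∸r₀) = large∈Γ (y ∸ r 0) (m+n≤o⇒m≤o∸n c c+r₀≤y)
  in  y∉r₀+Γ a (trans (cong (_+ r 0) Σ≡y∸r₀) (m∸n+n≡m (≤-trans (m≤n+m (r 0) c) c+r₀≤y)))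

cancel-first-generator : ∀ r₀ y c P Q → 3 * r₀ + 5 * P + 1 ≤ 3 * y + 9 * Q → y < c + r₀ →
  5 * P + 4 ≤ 3 * c + 9 * Q
cancel-first-generator r₀ y c P Q bound y<c+r₀ = +-cancelˡ-≤ (3 * r₀) _ _ (begin
  3 * r₀ + (5 * P + 4)     ≡⟨ split r₀ P ⟩
  3 * r₀ + 5 * P + 1 + 3   ≤⟨ +-monoˡ-≤ 3 bound ⟩
  3 * y + 9 * Q + 3        ≡⟨ merge y Q ⟩
  3 * suc y + 9 * Q        ≤⟨ +-monoˡ-≤ (9 * Q) (*-monoʳ-≤ 3 y<c+r₀) ⟩
  3 * (c + r₀) + 9 * Q     ≡⟨ reorder c r₀ Q ⟩
  3 * r₀ + (3 * c + 9 * Q) ∎)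
  where
  open ≤-Reasoning
  split : ∀ r₀ P → 3 * r₀ + (5 * P + 4) ≡ 3 * r₀ + 5 * P + 1 + 3
  split = solve-∀
  merge : ∀ y Q → 3 * y + 9 * Q + 3 ≡ 3 * suc y + 9 * Q
  merge = solve-∀
  reorder : ∀ c r₀ Q → 3 * (c + r₀) + 9 * Q ≡ 3 * r₀ + (3 * c + 9 * Q)
  reorder = solve-∀

-- For s ≥ 1, (10 s − 9)² = 20 (5 s² − 9 s + 4) + 1; with s = q + 1 no subtraction remains.
square-bound : ∀ s c → 1 ≤ s → 5 * (s * s) + 4 ≤ 3 * c + 9 * s → (10 * s ∸ 9) * (10 * s ∸ 9) ≤ 60 * c + 1
square-bound (suc q) c _ bound = begin
  (10 * suc q ∸ 9) * (10 * suc q ∸ 9) ≡⟨ cong (λ m → m * m) 10[1+q]∸9≡10q+1 ⟩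
  (10 * q + 1) * (10 * q + 1)         ≡⟨ square q ⟩
  20 * (5 * q * q + q) + 1            ≤⟨ +-monoˡ-≤ 1 (*-monoʳ-≤ 20 5q²+q≤3c) ⟩
  20 * (3 * c) + 1                    ≡⟨ cong (_+ 1) (sym (*-assoc 20 3 c)) ⟩
  60 * c + 1                          ∎
  where
  open ≤-Reasoning
  10[1+q]≡10q+1+9 : ∀ q → 10 * suc q ≡ 10 * q + 1 + 9
  10[1+q]≡10q+1+9 = solve-∀
  10[1+q]∸9≡10q+1 : 10 * suc q ∸ 9 ≡ 10 * q + 1
  10[1+q]∸9≡10q+1 = trans (cong (_∸ 9) (10[1+q]≡10q+1+9 q)) (m+n∸n≡m (10 * q + 1) 9)
  square : ∀ q → (10 * q + 1) * (10 * q + 1) ≡ 20 * (5 * q * q + q) + 1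
  square = solve-∀
  expand : ∀ q → 5 * (suc q * suc q) + 4 ≡ 5 * q * q + q + 9 * suc q
  expand = solve-∀
  5q²+q≤3c : 5 * q * q + q ≤ 3 * c
  5q²+q≤3c = +-cancelʳ-≤ (9 * suc q) _ _ (subst (_≤ 3 * c + 9 * suc q) (expand q) bound)

4^n≡2^n*2^n : ∀ n → 4 ^ n ≡ 2 ^ n * 2 ^ n
4^n≡2^n*2^n zero    = refl
4^n≡2^n*2^n (suc n) rewrite 4^n≡2^n*2^n n = regroup (2 ^ n)
  where
  regroup : ∀ x → 4 * (x * x) ≡ 2 * x * (2 * x)
  regroup = solve-∀

corollary5p4 : (h : ℕ) (r : ℕ → ℕ) (c : ℕ) →
    IsNumerical r h → IsMinimal r h → StrictlyIncreasing r h →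
    IsPlaneCurveSemigroup r h → IsConductor r h c → 2 ≤ h →
    (10 * 2 ^ h ∸ 9) * (10 * 2 ^ h ∸ 9) ≤ 60 * c + 1
corollary5p4 h r c _ _ r< (free , ineq) conductor _ =
  square-bound (2 ^ h) c (m^n>0 2 h)
    (subst (λ P → 5 * P + 4 ≤ 3 * c + 9 * 2 ^ h) (4^n≡2^n*2^n h)
      (cancel-first-generator (r 0) (shiftedFrobenius h r) c (4 ^ h) (2 ^ h)
        (shiftedFrobenius-bound h r free r< ineq)
        (NotInShifted⇒<conductor+r₀ conductor (shiftedFrobenius-gap h r free))))
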